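{- Let $n\ge3$ and ${\boldsymbol{a}}=(a_1,\dots,a_n)\in A_n$. Suppose that for some integer $1\le l\le n-1$ we have $a_1=\cdots=a_{l-1}=0$, $a_l>0$ and $a_{l+1}\ge0$, and that the first negative entry of ${\boldsymbol{a}}$ is $a_m$ with $l+2\le m<n$. Then there exists a flow $\boldsymbol{f}=(f_{i,j})\in\operatorname{Flow}_n({\boldsymbol{a}})$ such that: (i) $f_{l,m}>0$; (ii) $f_{l,m}+f_{l+1,m}+\cdots+f_{m-1,m}=-a_m$; (iii) the $m$-th row of $\boldsymbol{f}$ is a zero row; (iv) the first $l-1$ rows of $\boldsymbol{f}$ are zero rows.
   Context: $\mathbb{U}(n)$ is the space of upper triangular $n\times n$ real matrices $\boldsymbol{m}=(m_{i,j})_{1\le i\le j\le n}$; hook sums $\eta_i(\boldsymbol{m})=m_{i,i}+\sum_{i<j\le n}m_{i,j}-\sum_{1\le j<i}m_{j,i}$. For ${\boldsymbol{a}}\in\mathbb{R}^n$, $\operatorname{Flow}_n({\boldsymbol{a}})=\{\boldsymbol{m}\in\mathbb{U}(n):\eta_i(\boldsymbol{m})=a_i\ \forall i,\ m_{i,j}\ge0\ \forall\,1\le i\le j\le n\}$; its elements are flows. The $k$-th row of $\boldsymbol{m}$ consists of the entries $m_{k,k},m_{k,k+1},\dots,m_{k,n}$. $A_n$ is the set of ${\boldsymbol{a}}\in\mathbb{R}^n$ with $\sum_{i=1}^k a_i\ge0$ for all $1\le k\le n$. -}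

module Defs where

open import Level using (Level; suc)
open import Data.Nat using (ℕ; zero; _∸_) renaming (suc to 1+; _≤_ to _≤ℕ_)
open import Data.Sum using (_⊎_)
open import Data.Product using (_×_; ∃)
open import Relation.Binary.Core using (Rel)
open import Relation.Binary.Structures using (IsStrictTotalOrder)
open import Relation.Binary.PropositionalEquality using (_≡_; _≢_)
open import Algebra.Structures using (IsCommutativeRing)

-- An ordered field (with propositional equality).  The real numbers are an
-- instance; the statement is proved for every ordered field.
record OrderedField (c : Level) : Set (suc c) where
  infixl 7 _*_
  infixl 6 _+_ _-_
  infix 4 _<_ _≤ᶠ_
  field
    Carrier : Set c
    _+_ _*_ : Carrier → Carrier → Carrier
    -_      : Carrier → Carrier
    0# 1#   : Carrier
    isCommutativeRing : IsCommutativeRing _≡_ _+_ _*_ -_ 0# 1#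
    _<_ : Rel Carrier c
    isStrictTotalOrder : IsStrictTotalOrder _≡_ _<_
    0<1 : 0# < 1#
    +-mono-< : ∀ {x y} z → x < y → x + z < y + z
    *-pos : ∀ {x y} → 0# < x → 0# < y → 0# < x * y
    inverse : ∀ x → x ≢ 0# → ∃ λ y → x * y ≡ 1#

  _-_ : Carrier → Carrier → Carrier
  x - y = x + (- y)

  _≤ᶠ_ : Rel Carrier c
  x ≤ᶠ y = x < y ⊎ x ≡ y

module _ {c : Level} (F : OrderedField c) where
  open OrderedField F

  -- Σ_{i = lo}^{hi} f i  (empty, i.e. 0#, when hi < lo)
  sumFromCount : (ℕ → Carrier) → ℕ → ℕ → Carrier
  sumFromCount f i zero = 0#
  sumFromCount f i (1+ k) = f i + sumFromCount f (1+ i) k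

  sumRange : (ℕ → Carrier) → ℕ → ℕ → Carrier
  sumRange f lo hi = sumFromCount f lo (1+ hi ∸ lo)

  -- Matrices in 𝕌(n): entries m i j for 1 ≤ i ≤ j ≤ n (1-based indices);
  -- values at other indices are irrelevant.
  Mat : Set c
  Mat = ℕ → ℕ → Carrier

  η : ℕ → Mat → ℕ → Carrier
  η n m i = m i i + sumRange (λ j → m i j) (1+ i) n - sumRange (λ j → m j i) 1 (i ∸ 1)

  IsFlow : ℕ → (ℕ → Carrier) → Mat → Set c
  IsFlow n a m =
    (∀ i → 1 ≤ℕ i → i ≤ℕ n → η n m i ≡ a i) ×
    (∀ i j → 1 ≤ℕ i → i ≤ℕ j → j ≤ℕ n → 0# ≤ᶠ m i j)

  InA : ℕ → (ℕ → Carrier) → Set c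
  InA n a = ∀ k → 1 ≤ℕ k → k ≤ℕ n → 0# ≤ᶠ sumRange a 1 k

{-# OPTIONS --safe #-}
-- Routing the prefix sums S i = a 1 + ⋯ + a i along the path 1 → 2 → ⋯ → n (the last one on the
-- diagonal entry (n, n)) gives a flow, because a ∈ A_n; its hook sums are S i − S (i − 1).
-- An edge (p, q) of weight x changes the hook sums by the differences of x·[p ≤ i < q], so adding
-- the edges (l, m) of weight ε = min (a l) (− a m) and (m − 1, m + 1) of weight S m, and lowering
-- the load of the path by the corresponding windows, keeps every hook sum. The remaining load is
-- nonnegative: S i − ε ≥ a l − ε between l and m − 2, − a m − ε at m − 1, and 0 at m and before l.
-- So row m and the rows above l are empty, and (ii) is conservation at m.
module Submission where

open import Defs
open import Level using (Level)
open import Data.Nat using (ℕ; _≤_; _<_; _+_; _∸_)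
open import Data.Product using (_×_; ∃)
open import Relation.Binary.PropositionalEquality using (_≡_)

open import Data.Nat using (zero; suc; z≤n; s≤s; _⊓_; _≟_; _≤?_; _<?_; _≤′_; ≤′-reflexive; ≤′-step)
import Data.Nat.Properties as ℕ
open import Data.Product using (_,_)
open import Data.Sum using (inj₁; inj₂)
open import Relation.Nullary using (yes; no; contradiction)
open import Function using (_∘_)
open import Relation.Binary.Definitions using (tri<; tri≈; tri>)
open import Relation.Binary.PropositionalEquality
  using (_≢_; refl; sym; trans; cong; cong₂; subst; subst₂; module ≡-Reasoning)
open import Algebra.Bundles using (CommutativeRing)
open import Algebra.Structures using (IsCommutativeRing)
open import Relation.Binary.Bundles using (StrictTotalOrder)
open import Relation.Binary.Structures using (IsStrictTotalOrder)

module _ {c : Level} (F : OrderedField c) where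

  open OrderedField F
    renaming (_+_ to infixl 6 _+ᶠ_; _-_ to infixl 6 _-ᶠ_; _<_ to infix 4 _<ᶠ_)
  open IsCommutativeRing isCommutativeRing
    using (+-assoc; +-comm; +-identityˡ; +-identityʳ; -‿inverseˡ; -‿inverseʳ)
  open IsStrictTotalOrder isStrictTotalOrder using (compare)
  open ≡-Reasoning

  private
    ring : CommutativeRing c c
    ring = record { isCommutativeRing = isCommutativeRing }

    strictTotalOrder : StrictTotalOrder c c c
    strictTotalOrder = record { isStrictTotalOrder = isStrictTotalOrder }

  open CommutativeRing ring using (+-abelianGroup; +-group; +-commutativeSemigroup)
  open import Algebra.Properties.AbelianGroup +-abelianGroup using (⁻¹-∙-comm; xyx⁻¹≈y)
  open import Algebra.Properties.Group +-group using (ε⁻¹≈ε; ⁻¹-involutive; //-rightDividesˡ)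
  open import Algebra.Properties.CommutativeSemigroup +-commutativeSemigroup
    using (interchange; x∙yz≈y∙xz)
  open import Relation.Binary.Properties.StrictTotalOrder strictTotalOrder
    using () renaming (trans to ≤ᶠ-trans)

  x-0≡x : ∀ x → x -ᶠ 0# ≡ x
  x-0≡x x = trans (cong (x +ᶠ_) ε⁻¹≈ε) (+-identityʳ x)

  sub-interchange : ∀ x y u v → (x +ᶠ y) -ᶠ (u +ᶠ v) ≡ (x -ᶠ u) +ᶠ (y -ᶠ v)
  sub-interchange x y u v =
    trans (cong (x +ᶠ y +ᶠ_) (sym (⁻¹-∙-comm u v))) (interchange x y (- u) (- v))

  +-monoˡ-≤ᶠ : ∀ {x y} z → x ≤ᶠ y → x +ᶠ z ≤ᶠ y +ᶠ z
  +-monoˡ-≤ᶠ z (inj₁ x<y) = inj₁ (+-mono-< z x<y)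
  +-monoˡ-≤ᶠ z (inj₂ refl) = inj₂ refl

  x≤x+y : ∀ {x y} → 0# ≤ᶠ y → x ≤ᶠ x +ᶠ y
  x≤x+y {x} {y} 0≤y = subst₂ _≤ᶠ_ (+-identityˡ x) (+-comm y x) (+-monoˡ-≤ᶠ x 0≤y)

  +-nonneg : ∀ {x y} → 0# ≤ᶠ x → 0# ≤ᶠ y → 0# ≤ᶠ x +ᶠ y
  +-nonneg 0≤x 0≤y = ≤ᶠ-trans 0≤x (x≤x+y 0≤y)

  x≤y⇒0≤y-x : ∀ {x y} → x ≤ᶠ y → 0# ≤ᶠ y -ᶠ x
  x≤y⇒0≤y-x {x} x≤y = subst (_≤ᶠ _) (-‿inverseʳ x) (+-monoˡ-≤ᶠ (- x) x≤y)

  neg-pos : ∀ {x} → x <ᶠ 0# → 0# <ᶠ - x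
  neg-pos {x} x<0 = subst₂ _<ᶠ_ (-‿inverseʳ x) (+-identityˡ (- x)) (+-mono-< (- x) x<0)

  positive-lower-bound : ∀ {x y} → 0# <ᶠ x → 0# <ᶠ y → ∃ λ e → 0# <ᶠ e × e ≤ᶠ x × e ≤ᶠ y
  positive-lower-bound {x} {y} 0<x 0<y with compare x y
  ... | tri< x<y _ _ = x , 0<x , inj₂ refl , inj₁ x<y
  ... | tri≈ _ x≡y _ = x , 0<x , inj₂ refl , inj₂ x≡y
  ... | tri> _ _ y<x = y , 0<y , inj₁ y<x , inj₂ refl

  δ : ℕ → Carrier → ℕ → Carrier
  δ p x i with i ≟ p
  ... | yes _ = x
  ... | no _ = 0#

  δ-at : ∀ p x → δ p x p ≡ x
  δ-at p x with p ≟ p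
  ... | yes _ = refl
  ... | no p≢p = contradiction refl p≢p

  δ-off : ∀ {p i} x → i ≢ p → δ p x i ≡ 0#
  δ-off {p} {i} x i≢p with i ≟ p
  ... | yes i≡p = contradiction i≡p i≢p
  ... | no _ = refl

  δ-0 : ∀ p i → δ p 0# i ≡ 0#
  δ-0 p i with i ≟ p
  ... | yes _ = refl
  ... | no _ = refl

  -‿δ : ∀ p x i → - δ p x i ≡ δ p (- x) i
  -‿δ p x i with i ≟ p
  ... | yes _ = refl
  ... | no _ = ε⁻¹≈ε

  δ-nonneg : ∀ p {x} i → 0# ≤ᶠ x → 0# ≤ᶠ δ p x i
  δ-nonneg p i 0≤x with i ≟ p
  ... | yes _ = 0≤x
  ... | no _ = inj₂ refl

  step : ℕ → Carrier → ℕ → Carrier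
  step p x i with p ≤? i
  ... | yes _ = x
  ... | no _ = 0#

  step-≥ : ∀ {p i} x → p ≤ i → step p x i ≡ x
  step-≥ {p} {i} x p≤i with p ≤? i
  ... | yes _ = refl
  ... | no p≰i = contradiction p≤i p≰i

  step-< : ∀ {p i} x → i < p → step p x i ≡ 0#
  step-< {p} {i} x i<p with p ≤? i
  ... | yes p≤i = contradiction p≤i (ℕ.<⇒≱ i<p)
  ... | no _ = refl

  infixl 6 _⊕_
  _⊕_ : (ℕ → Carrier) → (ℕ → Carrier) → ℕ → Carrier
  (P ⊕ Q) i = P i +ᶠ Q i

  window : ℕ → ℕ → Carrier → ℕ → Carrier
  window p q x = step p x ⊕ step q (- x)

  window-below : ∀ {p q i} x → p ≤ q → i < p → window p q x i ≡ 0#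
  window-below x p≤q i<p =
    trans (cong₂ _+ᶠ_ (step-< x i<p) (step-< (- x) (ℕ.<-≤-trans i<p p≤q))) (+-identityˡ 0#)

  window-inside : ∀ {p q i} x → p ≤ i → i < q → window p q x i ≡ x
  window-inside x p≤i i<q = trans (cong₂ _+ᶠ_ (step-≥ x p≤i) (step-< (- x) i<q)) (+-identityʳ x)

  window-above : ∀ {p q i} x → p ≤ q → q ≤ i → window p q x i ≡ 0#
  window-above x p≤q q≤i =
    trans (cong₂ _+ᶠ_ (step-≥ x (ℕ.≤-trans p≤q q≤i)) (step-≥ (- x) q≤i)) (-‿inverseʳ x)

  Δ : (ℕ → Carrier) → ℕ → Carrier
  Δ P i = P i -ᶠ P (i ∸ 1)

  Δ-⊕ : ∀ P Q i → Δ (P ⊕ Q) i ≡ Δ P i +ᶠ Δ Q i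
  Δ-⊕ P Q i = sub-interchange (P i) (Q i) (P (i ∸ 1)) (Q (i ∸ 1))

  Δ-cong : ∀ {P Q} → (∀ i → P i ≡ Q i) → ∀ i → Δ P i ≡ Δ Q i
  Δ-cong P≗Q i = cong₂ _-ᶠ_ (P≗Q i) (P≗Q (i ∸ 1))

  Δ-step : ∀ {p} x i → 1 ≤ p → Δ (step p x) i ≡ δ p x i
  Δ-step {p} x i 1≤p with ℕ.<-cmp i p
  ... | tri< i<p i≢p _ = begin
    step p x i -ᶠ step p x (i ∸ 1)
      ≡⟨ cong₂ _-ᶠ_ (step-< x i<p) (step-< x (ℕ.≤-<-trans (ℕ.m∸n≤m i 1) i<p)) ⟩
    0# -ᶠ 0#  ≡⟨ -‿inverseʳ 0# ⟩
    0#        ≡⟨ sym (δ-off x i≢p) ⟩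
    δ p x i   ∎
  ... | tri≈ _ refl _ = begin
    step i x i -ᶠ step i x (i ∸ 1)
      ≡⟨ cong₂ _-ᶠ_ (step-≥ {i} x ℕ.≤-refl) (step-< {i} x (ℕ.∸-monoʳ-< (s≤s z≤n) 1≤p)) ⟩
    x -ᶠ 0#   ≡⟨ x-0≡x x ⟩
    x         ≡⟨ sym (δ-at i x) ⟩
    δ i x i   ∎
  ... | tri> _ i≢p p<i = begin
    step p x i -ᶠ step p x (i ∸ 1)
      ≡⟨ cong₂ _-ᶠ_ (step-≥ x (ℕ.<⇒≤ p<i)) (step-≥ x (ℕ.∸-monoˡ-≤ 1 p<i)) ⟩
    x -ᶠ x    ≡⟨ -‿inverseʳ x ⟩
    0#        ≡⟨ sym (δ-off x i≢p) ⟩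
    δ p x i   ∎

  sum-zero : ∀ g lo k → (∀ j → lo ≤ j → j < lo + k → g j ≡ 0#) → sumFromCount F g lo k ≡ 0#
  sum-zero g lo zero _ = refl
  sum-zero g lo (suc k) g≡0 = begin
    g lo +ᶠ sumFromCount F g (suc lo) k
      ≡⟨ cong₂ _+ᶠ_ (g≡0 lo ℕ.≤-refl (ℕ.m<m+n lo (s≤s z≤n)))
                    (sum-zero g (suc lo) k λ j lo<j j<end →
                       g≡0 j (ℕ.<⇒≤ lo<j) (subst (j <_) (sym (ℕ.+-suc lo k)) j<end)) ⟩
    0# +ᶠ 0#  ≡⟨ +-identityʳ 0# ⟩
    0#        ∎

  sum-single : ∀ g lo k {p} → lo ≤ p → p < lo + k →
               (∀ j → lo ≤ j → j < lo + k → j ≢ p → g j ≡ 0#) → sumFromCount F g lo k ≡ g p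
  sum-single g lo zero lo≤p p<lo+0 _ =
    contradiction (subst (_ <_) (ℕ.+-identityʳ lo) p<lo+0) (ℕ.≤⇒≯ lo≤p)
  sum-single g lo (suc k) {p} lo≤p p<end g≡0 with lo ≟ p
  ... | yes refl = begin
    g lo +ᶠ sumFromCount F g (suc lo) k
      ≡⟨ cong (g lo +ᶠ_) (sum-zero g (suc lo) k λ j lo<j j<end →
           g≡0 j (ℕ.<⇒≤ lo<j) (subst (j <_) (sym (ℕ.+-suc lo k)) j<end) (ℕ.>⇒≢ lo<j)) ⟩
    g lo +ᶠ 0#  ≡⟨ +-identityʳ (g lo) ⟩
    g lo        ∎
  ... | no lo≢p = begin
    g lo +ᶠ sumFromCount F g (suc lo) k
      ≡⟨ cong₂ _+ᶠ_ (g≡0 lo ℕ.≤-refl (ℕ.m<m+n lo (s≤s z≤n)) lo≢p)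
           (sum-single g (suc lo) k (ℕ.≤∧≢⇒< lo≤p lo≢p) (subst (p <_) (ℕ.+-suc lo k) p<end)
             λ j lo<j j<end → g≡0 j (ℕ.<⇒≤ lo<j) (subst (j <_) (sym (ℕ.+-suc lo k)) j<end)) ⟩
    0# +ᶠ g p   ≡⟨ +-identityˡ (g p) ⟩
    g p         ∎

  sum-+ : ∀ g h lo k →
          sumFromCount F (g ⊕ h) lo k ≡ sumFromCount F g lo k +ᶠ sumFromCount F h lo k
  sum-+ g h lo zero = sym (+-identityʳ 0#)
  sum-+ g h lo (suc k) =
    trans (cong (g lo +ᶠ h lo +ᶠ_) (sum-+ g h (suc lo) k)) (interchange _ _ _ _)

  sum-snoc : ∀ g lo k → sumFromCount F g lo (suc k) ≡ sumFromCount F g lo k +ᶠ g (lo + k)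
  sum-snoc g lo zero = begin
    g lo +ᶠ 0#      ≡⟨ +-identityʳ (g lo) ⟩
    g lo            ≡⟨ cong g (sym (ℕ.+-identityʳ lo)) ⟩
    g (lo + 0)      ≡⟨ sym (+-identityˡ (g (lo + 0))) ⟩
    0# +ᶠ g (lo + 0) ∎
  sum-snoc g lo (suc k) = begin
    g lo +ᶠ sumFromCount F g (suc lo) (suc k)
      ≡⟨ cong (g lo +ᶠ_) (sum-snoc g (suc lo) k) ⟩
    g lo +ᶠ (sumFromCount F g (suc lo) k +ᶠ g (suc lo + k))
      ≡⟨ sym (+-assoc _ _ _) ⟩
    g lo +ᶠ sumFromCount F g (suc lo) k +ᶠ g (suc lo + k)
      ≡⟨ cong (λ t → g lo +ᶠ sumFromCount F g (suc lo) k +ᶠ g t) (sym (ℕ.+-suc lo k)) ⟩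
    g lo +ᶠ sumFromCount F g (suc lo) k +ᶠ g (lo + suc k) ∎

  sumRange-drop-zero : ∀ g {lo} hi → lo ≤ hi → g lo ≡ 0# → sumRange F g lo hi ≡ sumRange F g (suc lo) hi
  sumRange-drop-zero g {lo} hi lo≤hi g≡0 = begin
    sumFromCount F g lo (suc hi ∸ lo)
      ≡⟨ cong (sumFromCount F g lo) (ℕ.+-∸-assoc 1 lo≤hi) ⟩
    g lo +ᶠ sumFromCount F g (suc lo) (hi ∸ lo)
      ≡⟨ cong (_+ᶠ sumFromCount F g (suc lo) (hi ∸ lo)) g≡0 ⟩
    0# +ᶠ sumFromCount F g (suc lo) (hi ∸ lo)
      ≡⟨ +-identityˡ _ ⟩
    sumFromCount F g (suc lo) (hi ∸ lo) ∎

  sumRange-skip-zeros : ∀ g {lo mid} hi → lo ≤′ mid → mid ≤ suc hi →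
                        (∀ j → lo ≤ j → j < mid → g j ≡ 0#) → sumRange F g lo hi ≡ sumRange F g mid hi
  sumRange-skip-zeros g hi (≤′-reflexive refl) _ _ = refl
  sumRange-skip-zeros g {lo} {suc mid} hi (≤′-step lo≤′mid) mid<suc-hi g≡0 =
    trans (sumRange-skip-zeros g hi lo≤′mid (ℕ.<⇒≤ mid<suc-hi)
             λ j lo≤j j<mid → g≡0 j lo≤j (ℕ.m<n⇒m<1+n j<mid))
          (sumRange-drop-zero g hi (ℕ.≤-pred mid<suc-hi)
             (g≡0 mid (ℕ.≤′⇒≤ lo≤′mid) ℕ.≤-refl))

  partialSum : (ℕ → Carrier) → ℕ → Carrier
  partialSum a k = sumRange F a 1 k

  partialSum-suc : ∀ a k → partialSum a (suc k) ≡ partialSum a k +ᶠ a (suc k)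
  partialSum-suc a k = sum-snoc a 1 k

  partialSum-pred : ∀ a {k} → 1 ≤ k → partialSum a k ≡ partialSum a (k ∸ 1) +ᶠ a k
  partialSum-pred a {suc k} _ = partialSum-suc a k

  Δ-partialSum : ∀ a {i} → 1 ≤ i → Δ (partialSum a) i ≡ a i
  Δ-partialSum a {suc k} _ =
    trans (cong (_-ᶠ partialSum a k) (partialSum-suc a k)) (xyx⁻¹≈y (partialSum a k) (a (suc k)))

  infixl 6 _⊞_
  _⊞_ : Mat F → Mat F → Mat F
  (M ⊞ N) i j = M i j +ᶠ N i j

  single : ℕ → ℕ → Carrier → Mat F
  single p q x i j = δ p (δ q x j) i

  single-nonneg : ∀ p q {x} i j → 0# ≤ᶠ x → 0# ≤ᶠ single p q x i j
  single-nonneg p q i j 0≤x = δ-nonneg p i (δ-nonneg q j 0≤x)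

  -- Vertex i sends P i to i + 1, except the last vertex n, which keeps P n on the diagonal.
  path : ℕ → (ℕ → Carrier) → Mat F
  path n P i j = δ (suc i ⊓ n) (P i) j

  outflow : ℕ → Mat F → ℕ → Carrier
  outflow n M i = sumFromCount F (M i) i (suc (n ∸ i))

  inflow : Mat F → ℕ → Carrier
  inflow M i = sumFromCount F (λ j → M j i) 1 (i ∸ 1)

  η≡outflow-inflow : ∀ n M i → η F n M i ≡ outflow n M i -ᶠ inflow M i
  η≡outflow-inflow n M i = refl

  outflow-zero : ∀ n M i → (∀ j → M i j ≡ 0#) → outflow n M i ≡ 0#
  outflow-zero n M i row≡0 = sum-zero (M i) i (suc (n ∸ i)) λ j _ _ → row≡0 j

  outflow-single-entry : ∀ n M i {t} → i ≤ t → t ≤ n →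
                         (∀ j → j ≢ t → M i j ≡ 0#) → outflow n M i ≡ M i t
  outflow-single-entry n M i {t} i≤t t≤n row≡0 =
    sum-single (M i) i (suc (n ∸ i)) i≤t t<end λ j _ _ → row≡0 j
    where
    t<end : t < i + suc (n ∸ i)
    t<end = subst (t <_) (sym (trans (ℕ.+-suc i (n ∸ i)) (cong suc (ℕ.m+[n∸m]≡n (ℕ.≤-trans i≤t t≤n)))))
                  (s≤s t≤n)

  inflow-zero : ∀ M i → (∀ j → M j i ≡ 0#) → inflow M i ≡ 0#
  inflow-zero M i col≡0 = sum-zero (λ j → M j i) 1 (i ∸ 1) λ j _ _ → col≡0 j

  inflow-single-entry : ∀ M i {s} → 1 ≤ s → s < i →
                        (∀ j → j < i → j ≢ s → M j i ≡ 0#) → inflow M i ≡ M s i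
  inflow-single-entry M i 1≤s s<i col≡0 =
    sum-single (λ j → M j i) 1 (i ∸ 1) 1≤s (subst (_ <_) (sym 1+[i∸1]≡i) s<i)
      λ j _ j<end → col≡0 j (subst (j <_) 1+[i∸1]≡i j<end)
    where
    1+[i∸1]≡i : 1 + (i ∸ 1) ≡ i
    1+[i∸1]≡i = ℕ.m+[n∸m]≡n (ℕ.≤-trans 1≤s (ℕ.<⇒≤ s<i))

  η-⊞ : ∀ n M N i → η F n (M ⊞ N) i ≡ η F n M i +ᶠ η F n N i
  η-⊞ n M N i = begin
    η F n (M ⊞ N) i
      ≡⟨ η≡outflow-inflow n (M ⊞ N) i ⟩
    outflow n (M ⊞ N) i -ᶠ inflow (M ⊞ N) i
      ≡⟨ cong₂ _-ᶠ_ (sum-+ (M i) (N i) i (suc (n ∸ i))) (sum-+ (λ j → M j i) (λ j → N j i) 1 (i ∸ 1)) ⟩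
    (outflow n M i +ᶠ outflow n N i) -ᶠ (inflow M i +ᶠ inflow N i)
      ≡⟨ sub-interchange _ _ _ _ ⟩
    (outflow n M i -ᶠ inflow M i) +ᶠ (outflow n N i -ᶠ inflow N i) ∎

  inflow-of-empty-row : ∀ n M i {x} → η F n M i ≡ x → (∀ j → M i j ≡ 0#) → inflow M i ≡ - x
  inflow-of-empty-row n M i {x} η≡x row≡0 = begin
    inflow M i                         ≡⟨ sym (⁻¹-involutive (inflow M i)) ⟩
    - (- inflow M i)                   ≡⟨ cong -_ (sym (+-identityˡ (- inflow M i))) ⟩
    - (0# -ᶠ inflow M i)               ≡⟨ cong (λ o → - (o -ᶠ inflow M i)) (sym (outflow-zero n M i row≡0)) ⟩
    - (outflow n M i -ᶠ inflow M i)    ≡⟨ cong -_ (sym (η≡outflow-inflow n M i)) ⟩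
    - η F n M i                        ≡⟨ cong -_ η≡x ⟩
    - x                                ∎

  outflow-single : ∀ n {p q} x i → p ≤ q → q ≤ n → outflow n (single p q x) i ≡ δ p x i
  outflow-single n {p} {q} x i p≤q q≤n with p ≟ i
  ... | yes refl = begin
    outflow n (single i q x) i
      ≡⟨ outflow-single-entry n (single i q x) i p≤q q≤n (λ j j≢q → trans (δ-at i _) (δ-off x j≢q)) ⟩
    δ i (δ q x q) i  ≡⟨ trans (δ-at i _) (δ-at q x) ⟩
    x                ≡⟨ sym (δ-at i x) ⟩
    δ i x i          ∎
  ... | no p≢i = trans (outflow-zero n (single p q x) i λ j → δ-off _ i≢p) (sym (δ-off x i≢p))
    where
    i≢p : i ≢ p
    i≢p = p≢i ∘ sym

  inflow-single : ∀ {p q} x i → 1 ≤ p → p < q → inflow (single p q x) i ≡ δ q x i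
  inflow-single {p} {q} x i 1≤p p<q with q ≟ i
  ... | yes refl = begin
    inflow (single p i x) i
      ≡⟨ inflow-single-entry (single p i x) i 1≤p p<q (λ j _ j≢p → δ-off _ j≢p) ⟩
    δ p (δ i x i) p  ≡⟨ trans (δ-at p _) (δ-at i x) ⟩
    x                ≡⟨ sym (δ-at i x) ⟩
    δ i x i          ∎
  ... | no q≢i = trans (inflow-zero (single p q x) i λ j → trans (cong (λ y → δ p y j) (δ-off x i≢q)) (δ-0 p j))
                       (sym (δ-off x i≢q))
    where
    i≢q : i ≢ q
    i≢q = q≢i ∘ sym

  η-single : ∀ n {p q} x i → 1 ≤ p → p < q → q ≤ n → η F n (single p q x) i ≡ δ p x i +ᶠ δ q (- x) i
  η-single n x i 1≤p p<q q≤n =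
    trans (cong₂ _-ᶠ_ (outflow-single n x i (ℕ.<⇒≤ p<q) q≤n) (inflow-single x i 1≤p p<q))
          (cong (_ +ᶠ_) (-‿δ _ x i))

  η-single≡Δwindow : ∀ n {p q} x i → 1 ≤ p → p < q → q ≤ n →
                     η F n (single p q x) i ≡ Δ (window p q x) i
  η-single≡Δwindow n {p} {q} x i 1≤p p<q q≤n = begin
    η F n (single p q x) i                  ≡⟨ η-single n x i 1≤p p<q q≤n ⟩
    δ p x i +ᶠ δ q (- x) i                  ≡⟨ sym (cong₂ _+ᶠ_ (Δ-step x i 1≤p) (Δ-step (- x) i 1≤q)) ⟩
    Δ (step p x) i +ᶠ Δ (step q (- x)) i    ≡⟨ sym (Δ-⊕ (step p x) (step q (- x)) i) ⟩
    Δ (window p q x) i                      ∎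
    where
    1≤q : 1 ≤ q
    1≤q = ℕ.≤-trans 1≤p (ℕ.<⇒≤ p<q)

  outflow-path : ∀ n P i → i ≤ n → outflow n (path n P) i ≡ P i
  outflow-path n P i i≤n =
    trans (outflow-single-entry n (path n P) i (ℕ.⊓-glb (ℕ.n≤1+n i) i≤n) (ℕ.m⊓n≤n (suc i) n)
             λ j j≢t → δ-off (P i) j≢t)
          (δ-at (suc i ⊓ n) (P i))

  inflow-path : ∀ n P i → P 0 ≡ 0# → 1 ≤ i → i ≤ n → inflow (path n P) i ≡ P (i ∸ 1)
  inflow-path n P (suc zero) P0≡0 _ _ = sym P0≡0
  inflow-path n P (suc (suc k)) _ _ i≤n = begin
    inflow (path n P) (suc (suc k))
      ≡⟨ inflow-single-entry (path n P) (suc (suc k)) (s≤s z≤n) ℕ.≤-refl off-diagonal ⟩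
    δ (suc (suc k) ⊓ n) (P (suc k)) (suc (suc k))
      ≡⟨ cong (λ t → δ t (P (suc k)) (suc (suc k))) (ℕ.m≤n⇒m⊓n≡m i≤n) ⟩
    δ (suc (suc k)) (P (suc k)) (suc (suc k))
      ≡⟨ δ-at (suc (suc k)) (P (suc k)) ⟩
    P (suc k) ∎
    where
    off-diagonal : ∀ j → j < suc (suc k) → j ≢ suc k → δ (suc j ⊓ n) (P j) (suc (suc k)) ≡ 0#
    off-diagonal j j<i j≢k = δ-off (P j) λ i≡t →
      j≢k (sym (ℕ.suc-injective (trans i≡t (ℕ.m≤n⇒m⊓n≡m (ℕ.≤-trans j<i i≤n)))))

  η-path : ∀ n P i → P 0 ≡ 0# → 1 ≤ i → i ≤ n → η F n (path n P) i ≡ Δ P i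
  η-path n P i P0≡0 1≤i i≤n = cong₂ _-ᶠ_ (outflow-path n P i i≤n) (inflow-path n P i P0≡0 1≤i i≤n)

  module Construction
    (n : ℕ) (a : ℕ → Carrier) (l m : ℕ) (ε : Carrier)
    (a∈A : InA F n a) (1≤l : 1 ≤ l) (a<l≡0 : ∀ i → 1 ≤ i → i < l → a i ≡ 0#)
    (l+2≤m : l + 2 ≤ m) (m<n : m < n) (a<m≥0 : ∀ i → 1 ≤ i → i < m → 0# ≤ᶠ a i)
    (0<ε : 0# <ᶠ ε) (ε≤aₗ : ε ≤ᶠ a l) (ε≤-aₘ : ε ≤ᶠ - a m)
    where

    l<m∸1 : l < m ∸ 1
    l<m∸1 = ℕ.∸-monoˡ-≤ 1 (subst (_≤ m) (ℕ.+-comm l 2) l+2≤m)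

    1≤m∸1 : 1 ≤ m ∸ 1
    1≤m∸1 = ℕ.≤-trans 1≤l (ℕ.<⇒≤ l<m∸1)

    1≤m : 1 ≤ m
    1≤m = ℕ.≤-trans 1≤m∸1 (ℕ.m∸n≤m m 1)

    m∸1<m : m ∸ 1 < m
    m∸1<m = ℕ.∸-monoʳ-< (s≤s z≤n) 1≤m

    l<m : l < m
    l<m = ℕ.<-trans l<m∸1 m∸1<m

    m∸1≤suc-m : m ∸ 1 ≤ suc m
    m∸1≤suc-m = ℕ.m≤n⇒m≤1+n (ℕ.m∸n≤m m 1)

    S : ℕ → Carrier
    S = partialSum a

    T : ℕ → Carrier
    T = window l m ε ⊕ window (m ∸ 1) (suc m) (S m)

    P : ℕ → Carrier
    P i = S i -ᶠ T i

    bypass : Mat F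
    bypass = single l m ε ⊞ single (m ∸ 1) (suc m) (S m)

    flow : Mat F
    flow = path n P ⊞ bypass

    S-below-l : ∀ {i} → i < l → S i ≡ 0#
    S-below-l {zero} _ = refl
    S-below-l {suc k} k<l = begin
      S (suc k)         ≡⟨ partialSum-suc a k ⟩
      S k +ᶠ a (suc k)  ≡⟨ cong₂ _+ᶠ_ (S-below-l (ℕ.<-trans (ℕ.n<1+n k) k<l)) (a<l≡0 (suc k) (s≤s z≤n) k<l) ⟩
      0# +ᶠ 0#          ≡⟨ +-identityʳ 0# ⟩
      0#                ∎

    S-l : S l ≡ a l
    S-l = begin
      S l                    ≡⟨ partialSum-pred a 1≤l ⟩
      S (l ∸ 1) +ᶠ a l       ≡⟨ cong (_+ᶠ a l) (S-below-l (ℕ.∸-monoʳ-< (s≤s z≤n) 1≤l)) ⟩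
      0# +ᶠ a l              ≡⟨ +-identityˡ (a l) ⟩
      a l                    ∎

    aₗ≤S : ∀ {i} → l ≤ i → i < m → a l ≤ᶠ S i
    aₗ≤S l≤i i<m with ℕ.m≤n⇒m<n∨m≡n l≤i
    ... | inj₂ refl = inj₂ (sym S-l)
    ... | inj₁ (s≤s {n = k} l≤k) =
      ≤ᶠ-trans (aₗ≤S l≤k (ℕ.<-trans (ℕ.n<1+n k) i<m))
               (subst (S k ≤ᶠ_) (sym (partialSum-suc a k)) (x≤x+y (a<m≥0 (suc k) (s≤s z≤n) i<m)))

    ε+Sₘ≤Sₘ₋₁ : ε +ᶠ S m ≤ᶠ S (m ∸ 1)
    ε+Sₘ≤Sₘ₋₁ = subst₂ _≤ᶠ_ (cong (ε +ᶠ_) (sym (partialSum-pred a 1≤m))) cancel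
                           (+-monoˡ-≤ᶠ (S (m ∸ 1) +ᶠ a m) ε≤-aₘ)
      where
      cancel : - a m +ᶠ (S (m ∸ 1) +ᶠ a m) ≡ S (m ∸ 1)
      cancel = trans (x∙yz≈y∙xz (- a m) (S (m ∸ 1)) (a m))
                     (trans (cong (S (m ∸ 1) +ᶠ_) (-‿inverseˡ (a m))) (+-identityʳ (S (m ∸ 1))))

    T-below-l : ∀ {i} → i < l → T i ≡ 0#
    T-below-l i<l =
      trans (cong₂ _+ᶠ_ (window-below ε (ℕ.<⇒≤ l<m) i<l)
                        (window-below (S m) m∸1≤suc-m (ℕ.<-trans i<l l<m∸1)))
            (+-identityˡ 0#)

    T-between : ∀ {i} → l ≤ i → i < m ∸ 1 → T i ≡ ε
    T-between l≤i i<m∸1 =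
      trans (cong₂ _+ᶠ_ (window-inside ε l≤i (ℕ.<-trans i<m∸1 m∸1<m))
                        (window-below (S m) m∸1≤suc-m i<m∸1))
            (+-identityʳ ε)

    T-at-m∸1 : T (m ∸ 1) ≡ ε +ᶠ S m
    T-at-m∸1 = cong₂ _+ᶠ_ (window-inside ε (ℕ.<⇒≤ l<m∸1) m∸1<m)
                          (window-inside (S m) ℕ.≤-refl (ℕ.m<n⇒m<1+n m∸1<m))

    T-at-m : T m ≡ S m
    T-at-m = trans (cong₂ _+ᶠ_ (window-above ε (ℕ.<⇒≤ l<m) ℕ.≤-refl)
                               (window-inside (S m) (ℕ.<⇒≤ m∸1<m) (ℕ.n<1+n m)))
                   (+-identityˡ (S m))

    T-above-m : ∀ {i} → m < i → T i ≡ 0#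
    T-above-m m<i =
      trans (cong₂ _+ᶠ_ (window-above ε (ℕ.<⇒≤ l<m) (ℕ.<⇒≤ m<i)) (window-above (S m) m∸1≤suc-m m<i))
            (+-identityˡ 0#)

    T≤S : ∀ i → i ≤ n → T i ≤ᶠ S i
    T≤S i i≤n with i <? l
    ... | yes i<l = inj₂ (trans (T-below-l i<l) (sym (S-below-l i<l)))
    ... | no i≮l with ℕ.<-cmp i (m ∸ 1)
    ...   | tri< i<m∸1 _ _ =
      subst (_≤ᶠ S i) (sym (T-between (ℕ.≮⇒≥ i≮l) i<m∸1))
            (≤ᶠ-trans ε≤aₗ (aₗ≤S (ℕ.≮⇒≥ i≮l) (ℕ.<-trans i<m∸1 m∸1<m)))
    ...   | tri≈ _ refl _ = subst (_≤ᶠ S (m ∸ 1)) (sym T-at-m∸1) ε+Sₘ≤Sₘ₋₁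
    ...   | tri> _ _ m∸1<i with ℕ.m≤n⇒m<n∨m≡n (subst (_≤ i) (ℕ.m+[n∸m]≡n 1≤m) m∸1<i)
    ...     | inj₁ m<i = subst (_≤ᶠ S i) (sym (T-above-m m<i)) (a∈A i (ℕ.≤-trans 1≤m (ℕ.<⇒≤ m<i)) i≤n)
    ...     | inj₂ refl = inj₂ T-at-m

    P-nonneg : ∀ {i} → i ≤ n → 0# ≤ᶠ P i
    P-nonneg {i} i≤n = x≤y⇒0≤y-x (T≤S i i≤n)

    P-vanishes : ∀ {i} → T i ≡ S i → P i ≡ 0#
    P-vanishes {i} T≡S = trans (cong (S i -ᶠ_) T≡S) (-‿inverseʳ (S i))

    P-below-l : ∀ {i} → i < l → P i ≡ 0#
    P-below-l i<l = P-vanishes (trans (T-below-l i<l) (sym (S-below-l i<l)))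

    P⊕T≗S : ∀ i → (P ⊕ T) i ≡ S i
    P⊕T≗S i = //-rightDividesˡ (T i) (S i)

    η-bypass : ∀ i → η F n bypass i ≡ Δ T i
    η-bypass i = begin
      η F n bypass i
        ≡⟨ η-⊞ n (single l m ε) (single (m ∸ 1) (suc m) (S m)) i ⟩
      η F n (single l m ε) i +ᶠ η F n (single (m ∸ 1) (suc m) (S m)) i
        ≡⟨ cong₂ _+ᶠ_ (η-single≡Δwindow n ε i 1≤l l<m (ℕ.<⇒≤ m<n))
                      (η-single≡Δwindow n (S m) i 1≤m∸1 (ℕ.m<n⇒m<1+n m∸1<m) m<n) ⟩
      Δ (window l m ε) i +ᶠ Δ (window (m ∸ 1) (suc m) (S m)) i
        ≡⟨ sym (Δ-⊕ (window l m ε) (window (m ∸ 1) (suc m) (S m)) i) ⟩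
      Δ T i ∎

    flow-η : ∀ i → 1 ≤ i → i ≤ n → η F n flow i ≡ a i
    flow-η i 1≤i i≤n = begin
      η F n flow i                          ≡⟨ η-⊞ n (path n P) bypass i ⟩
      η F n (path n P) i +ᶠ η F n bypass i  ≡⟨ cong₂ _+ᶠ_ (η-path n P i (P-below-l 1≤l) 1≤i i≤n) (η-bypass i) ⟩
      Δ P i +ᶠ Δ T i                        ≡⟨ sym (Δ-⊕ P T i) ⟩
      Δ (P ⊕ T) i                           ≡⟨ Δ-cong P⊕T≗S i ⟩
      Δ S i                                 ≡⟨ Δ-partialSum a 1≤i ⟩
      a i                                   ∎

    flow-nonneg : ∀ i j → 1 ≤ i → i ≤ j → j ≤ n → 0# ≤ᶠ flow i j
    flow-nonneg i j _ i≤j j≤n =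
      +-nonneg (δ-nonneg (suc i ⊓ n) j (P-nonneg (ℕ.≤-trans i≤j j≤n)))
               (+-nonneg (single-nonneg l m i j (inj₁ 0<ε))
                         (single-nonneg (m ∸ 1) (suc m) i j (a∈A m 1≤m (ℕ.<⇒≤ m<n))))

    flow-row-zero : ∀ {i} j → i ≢ l → i ≢ m ∸ 1 → P i ≡ 0# → flow i j ≡ 0#
    flow-row-zero {i} j i≢l i≢m∸1 Pᵢ≡0 = begin
      δ (suc i ⊓ n) (P i) j +ᶠ (single l m ε i j +ᶠ single (m ∸ 1) (suc m) (S m) i j)
        ≡⟨ cong₂ _+ᶠ_ (trans (cong (λ x → δ (suc i ⊓ n) x j) Pᵢ≡0) (δ-0 (suc i ⊓ n) j))
                      (cong₂ _+ᶠ_ (δ-off _ i≢l) (δ-off _ i≢m∸1)) ⟩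
      0# +ᶠ (0# +ᶠ 0#)  ≡⟨ trans (+-identityˡ (0# +ᶠ 0#)) (+-identityˡ 0#) ⟩
      0#                ∎

    flow-row-m : ∀ j → flow m j ≡ 0#
    flow-row-m j = flow-row-zero j (ℕ.>⇒≢ l<m) (ℕ.>⇒≢ m∸1<m) (P-vanishes T-at-m)

    flow-rows<l : ∀ i j → i < l → flow i j ≡ 0#
    flow-rows<l i j i<l = flow-row-zero j (ℕ.<⇒≢ i<l) (ℕ.<⇒≢ (ℕ.<-trans i<l l<m∸1)) (P-below-l i<l)

    flow-l-m : flow l m ≡ ε
    flow-l-m = begin
      δ (suc l ⊓ n) (P l) m +ᶠ (single l m ε l m +ᶠ single (m ∸ 1) (suc m) (S m) l m)
        ≡⟨ cong₂ _+ᶠ_ (δ-off (P l) m≢suc-l⊓n)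
                      (cong₂ _+ᶠ_ (trans (δ-at l (δ m ε m)) (δ-at m ε)) (δ-off _ (ℕ.<⇒≢ l<m∸1))) ⟩
      0# +ᶠ (ε +ᶠ 0#)  ≡⟨ trans (+-identityˡ (ε +ᶠ 0#)) (+-identityʳ ε) ⟩
      ε                ∎
      where
      suc-l<m : suc l < m
      suc-l<m = ℕ.<-≤-trans (s≤s l<m∸1) (subst (_≤ m) (sym (ℕ.m+[n∸m]≡n 1≤m)) ℕ.≤-refl)
      m≢suc-l⊓n : m ≢ suc l ⊓ n
      m≢suc-l⊓n m≡ = ℕ.<⇒≢ suc-l<m (sym (trans m≡ (ℕ.m≤n⇒m⊓n≡m (ℕ.<⇒≤ (ℕ.<-trans suc-l<m m<n)))))

    flow-column-m : sumRange F (λ i → flow i m) l (m ∸ 1) ≡ - a m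
    flow-column-m = begin
      sumRange F (λ i → flow i m) l (m ∸ 1)
        ≡⟨ sym (sumRange-skip-zeros (λ i → flow i m) (m ∸ 1) (ℕ.≤⇒≤′ 1≤l)
                  (ℕ.m≤n⇒m≤1+n (ℕ.<⇒≤ l<m∸1)) λ i _ i<l → flow-rows<l i m i<l) ⟩
      inflow flow m
        ≡⟨ inflow-of-empty-row n flow m (flow-η m 1≤m (ℕ.<⇒≤ m<n)) flow-row-m ⟩
      - a m ∎

lemma5p10 : ∀ {c : Level} (F : OrderedField c) (n : ℕ) (a : ℕ → OrderedField.Carrier F) (l m : ℕ) →
    3 ≤ n →
    InA F n a →
    1 ≤ l → l ≤ n ∸ 1 →
    (∀ i → 1 ≤ i → i < l → a i ≡ OrderedField.0# F) →
    OrderedField._<_ F (OrderedField.0# F) (a l) →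
    OrderedField._≤ᶠ_ F (OrderedField.0# F) (a (l + 1)) →
    l + 2 ≤ m → m < n →
    OrderedField._<_ F (a m) (OrderedField.0# F) →
    (∀ i → 1 ≤ i → i < m → OrderedField._≤ᶠ_ F (OrderedField.0# F) (a i)) →
    ∃ λ (f : Mat F) →
      IsFlow F n a f ×
      OrderedField._<_ F (OrderedField.0# F) (f l m) ×
      sumRange F (λ i → f i m) l (m ∸ 1) ≡ OrderedField.-_ F (a m) ×
      (∀ j → m ≤ j → j ≤ n → f m j ≡ OrderedField.0# F) ×
      (∀ i j → 1 ≤ i → i < l → i ≤ j → j ≤ n → f i j ≡ OrderedField.0# F)
lemma5p10 F n a l m _ a∈A 1≤l _ a<l≡0 0<aₗ _ l+2≤m m<n aₘ<0 a<m≥0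
  with positive-lower-bound F 0<aₗ (neg-pos F aₘ<0)
... | ε , 0<ε , ε≤aₗ , ε≤-aₘ =
  flow , (flow-η , flow-nonneg) , subst (OrderedField._<_ F (OrderedField.0# F)) (sym flow-l-m) 0<ε ,
  flow-column-m , (λ j _ _ → flow-row-m j) , (λ i j _ i<l _ _ → flow-rows<l i j i<l)
  where open Construction F n a l m ε a∈A 1≤l a<l≡0 l+2≤m m<n a<m≥0 0<ε ε≤aₗ ε≤-aₘ
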